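{- Let $S$ be a skip graph with $n$ nodes and alphabet $\{0,1\}$, and let $A$ be a fixed subset of $m \le n/2$ of its nodes. Then for any integer $\ell \ge 0$, $$\Pr\left[|\delta_\ell A| \le \tfrac{1}{3}\cdot 2^\ell\right] < 2\binom{2^\ell}{\lfloor \frac{2}{3}\cdot 2^\ell\rfloor}\left(\tfrac{2}{3}\right)^m.$$
   Context: Skip graph: a finite set of $n$ nodes with distinct keys from a totally ordered set; each node $x$ has a membership vector $m(x)\in\{0,1\}^\omega$ whose bits are independent and uniformly random. For each finite binary word $w$, $S_w$ is the list of nodes whose membership vector has prefix $w$, sorted by key; $S_w$ is at level $|w|$. Two nodes are joined by an edge at level $\ell$ if they are adjacent in some list $S_w$ with $|w| = \ell$. For a set $A$ of nodes, $\delta_\ell A$ is the set of nodes not in $A$ that are joined by an edge at level $\ell$ to some node of $A$. The probability is over the random membership vectors. -}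

module Defs where

open import Data.Nat using (ℕ; zero; suc; _<_; _<?_; _*_; _^_; _≤?_)
open import Data.Bool using (Bool; true; false)
import Data.Bool.Properties as BoolP
open import Data.Fin using (Fin; toℕ)
open import Data.Fin.Properties using (any?; all?) renaming (_≟_ to _≟ᶠ_)
open import Data.Fin.Subset using (Subset; _∈_; _∉_)
open import Data.Fin.Subset.Properties using (_∈?_)
open import Data.Vec using (Vec; []; _∷_; lookup)
import Data.Vec.Properties as VecP
open import Data.List using (List; []; _∷_; concatMap; map; filter; length; allFin)
open import Data.Product using (_×_; ∃; _,_)
open import Data.Sum using (_⊎_)
open import Relation.Nullary using (Dec; ¬_; _×-dec_; _⊎-dec_; _→-dec_; ¬?)
open import Relation.Binary.PropositionalEquality using (_≡_; _≢_)

-- Nodes of a skip graph with n nodes are identified with Fin n, the key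
-- order being the order of Fin n (any n distinct keys from a totally
-- ordered set are order-isomorphic to this).
--
-- A membership assignment truncated at level ℓ: node x gets the word
-- (first ℓ bits of m(x)) = lookup M x.  Everything at level ℓ depends only
-- on these bits.
Assign : ℕ → ℕ → Set
Assign n ℓ = Vec (Vec Bool ℓ) n

allWords : (k : ℕ) → List (Vec Bool k)
allWords zero    = [] ∷ []
allWords (suc k) = concatMap (λ w → (false ∷ w) ∷ (true ∷ w) ∷ []) (allWords k)

allAssign : (n ℓ : ℕ) → List (Assign n ℓ)
allAssign zero    ℓ = [] ∷ []
allAssign (suc n) ℓ = concatMap (λ M → map (λ w → w ∷ M) (allWords ℓ)) (allAssign n ℓ)

StrictlyBetween : ∀ {n} → Fin n → Fin n → Fin n → Set
StrictlyBetween x z y = (toℕ x < toℕ z × toℕ z < toℕ y) ⊎ (toℕ y < toℕ z × toℕ z < toℕ x)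

-- x and y are adjacent in some list S_w with |w| = ℓ: they are distinct,
-- have the same length-ℓ prefix w, and no node of S_w lies strictly
-- between them in key order.
Edge : ∀ {n ℓ} → Assign n ℓ → Fin n → Fin n → Set
Edge M x y = x ≢ y × lookup M x ≡ lookup M y
           × (∀ z → StrictlyBetween x z y → lookup M z ≢ lookup M x)

InBoundary : ∀ {n ℓ} → Subset n → Assign n ℓ → Fin n → Set
InBoundary A M y = y ∉ A × ∃ λ x → x ∈ A × Edge M x y

private
  word? : ∀ {k} (u v : Vec Bool k) → Dec (u ≡ v)
  word? = VecP.≡-dec BoolP._≟_

between? : ∀ {n} (x z y : Fin n) → Dec (StrictlyBetween x z y)
between? x z y = ((toℕ x <? toℕ z) ×-dec (toℕ z <? toℕ y)) ⊎-dec ((toℕ y <? toℕ z) ×-dec (toℕ z <? toℕ x))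

edge? : ∀ {n ℓ} (M : Assign n ℓ) (x y : Fin n) → Dec (Edge M x y)
edge? M x y = ¬? (x ≟ᶠ y) ×-dec (word? (lookup M x) (lookup M y)
  ×-dec all? (λ z → between? x z y →-dec ¬? (word? (lookup M z) (lookup M x))))

inBoundary? : ∀ {n ℓ} (A : Subset n) (M : Assign n ℓ) (y : Fin n) → Dec (InBoundary A M y)
inBoundary? A M y = ¬? (y ∈? A) ×-dec any? (λ x → (x ∈? A) ×-dec edge? M x y)

boundarySize : ∀ {n ℓ} → Subset n → Assign n ℓ → ℕ
boundarySize {n} A M = length (filter (inBoundary? A M) (allFin n))

-- Number of (equally likely) assignments with 3·|δ_ℓ A| ≤ 2^ℓ,
-- i.e. |δ_ℓ A| ≤ (1/3)·2^ℓ.  The probability is this number / 2^(n·ℓ).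
badCount : (n ℓ : ℕ) → Subset n → ℕ
badCount n ℓ A = length (filter (λ M → 3 * boundarySize A M ≤? 2 ^ ℓ) (allAssign n ℓ))

{-# OPTIONS --safe #-}
-- Let W_A and W_B be the sets of words (level-ℓ prefixes of membership vectors) used by the
-- nodes of A and by the nodes outside A. If a word w is used on both sides, bisecting the list
-- S_w between a node of A and a node outside A yields an edge of S_w leaving A, so w is the word
-- of a node of δ_ℓ A; hence |W_A| + |W_B| ≤ 2^ℓ + |δ_ℓ A|. When 3|δ_ℓ A| ≤ 2^ℓ this forces
-- |W_A| ≤ k or |W_B| ≤ k for k = ⌊2·2^ℓ/3⌋. A fixed set of m nodes uses at most k words in at
-- most C(2^ℓ, k)·k^m·2^(ℓ(n−m)) assignments, and as 3k < 2·2^ℓ (3 does not divide 2^(ℓ+1)) and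
-- m ≤ n − m, the two resulting bounds add up to less than 2·C(2^ℓ, k)·(2/3)^m·2^(nℓ).

module Submission where

open import Data.Bool using (Bool; true; false; not; if_then_else_)
import Data.Bool.Properties as Bool
open import Data.Fin using (Fin; toℕ; zero; suc)
open import Data.Fin.Properties using (any?)
open import Data.Fin.Subset using (Subset; ∣_∣; _∈_; _∉_; ∁)
open import Data.Fin.Subset.Properties using (_∈?_; x∈∁p⇒x∉p; ∣p∣≤n; ∣∁p∣≡n∸∣p∣)
open import Data.List using (List; []; _∷_; _++_; _∷ʳ_; map; concatMap; filter; length; allFin)
open import Data.List.Membership.Propositional using () renaming (_∈_ to _∈ˡ_; _∉_ to _∉ˡ_)
open import Data.List.Membership.Propositional.Properties using (∈-++⁻; ∈-++⁺ˡ; ∈-++⁺ʳ; ∈-map⁺; ∈-filter⁺; ∈-allFin)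
open import Data.List.Properties using (map-++; map-∘; map-cong; length-map; length-filter; ++-assoc)
open import Data.List.Relation.Unary.Any as Any using (here; there; toSum)
open import Data.Nat
  using (ℕ; zero; suc; NonZero; >-nonZero; _+_; _*_; _^_; _/_; _%_; ∣_-_∣; _≤_; _<_; _>_; _≤?_; z≤n; s≤s; z<s)
open import Data.Nat.Combinatorics using (_C_; nCk+nC[k+1]≡[n+1]C[k+1]; nC1≡n; k>n⇒nCk≡0)
open import Data.Nat.Coprimality using (Coprime; gcd≡1⇒coprime; coprime-divisor)
open import Data.Nat.Divisibility using (_∣_; divides; ∣1⇒≡1)
open import Data.Nat.DivMod using (m≡m%n+[m/n]*n; m%n<n; m/n*n≤m)
open import Data.Nat.Induction using (<-wellFounded)
open import Data.Nat.ListAction using (sum)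
open import Data.Nat.ListAction.Properties using (sum-++)
open import Data.Nat.Properties
open import Data.Nat.Tactic.RingSolver using (solve-∀)
open import Data.Product using (_×_; _,_; proj₁; proj₂; ∃-syntax; uncurry)
open import Data.Sum using (_⊎_; inj₁; inj₂; [_,_])
open import Data.Vec using (Vec; []; _∷_; lookup; here; there)
import Data.Vec.Properties as Vec
open import Function using (_∘_; id)
open import Induction.WellFounded using (Acc; acc)
open import Level using (Level)
open import Relation.Binary.Definitions using (DecidableEquality)
open import Relation.Binary.PropositionalEquality hiding ([_])
open import Relation.Nullary using (Dec; does; yes; no; ¬_; ¬?; _×-dec_; _⊎-dec_; contradiction)

open import Defs

private
  variable
    α β γ : Level
    A : Set α
    P : Set β
    Q : Set γ

-- Counting by indicator sums

-- Defined through does, so that χ of a comparison of words reduces letter by letter.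
χ : Dec P → ℕ
χ d = if does d then 1 else 0

χ≤1 : (d : Dec P) → χ d ≤ 1
χ≤1 (yes _) = ≤-refl
χ≤1 (no _)  = z≤n

χ-mono : (d : Dec P) (e : Dec Q) → (P → Q) → χ d ≤ χ e
χ-mono (yes p) (yes _)  _ = ≤-refl
χ-mono (yes p) (no ¬q)  f = contradiction (f p) ¬q
χ-mono (no _)  _        _ = z≤n

χ-cong : (d : Dec P) (e : Dec Q) → (P → Q) → (Q → P) → χ d ≡ χ e
χ-cong d e f g = ≤-antisym (χ-mono d e f) (χ-mono e d g)

χ-⊎-× : (d : Dec P) (e : Dec Q) → χ (d ⊎-dec e) + χ (d ×-dec e) ≡ χ d + χ e
χ-⊎-× (yes _) (yes _) = refl
χ-⊎-× (yes _) (no _)  = refl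
χ-⊎-× (no _)  (yes _) = refl
χ-⊎-× (no _)  (no _)  = refl

χ-¬ : (d : Dec P) → χ d + χ (¬? d) ≡ 1
χ-¬ (yes _) = refl
χ-¬ (no _)  = refl

∑ : List A → (A → ℕ) → ℕ
∑ xs f = sum (map f xs)

syntax ∑ xs (λ x → e) = ∑[ x ← xs ] e

module _ {A : Set α} where

  ∑-cong : ∀ xs {f g : A → ℕ} → (∀ x → f x ≡ g x) → ∑ xs f ≡ ∑ xs g
  ∑-cong xs f≗g = cong sum (map-cong f≗g xs)

  ∑-mono : ∀ xs {f g : A → ℕ} → (∀ x → f x ≤ g x) → ∑ xs f ≤ ∑ xs g
  ∑-mono []       _   = z≤n
  ∑-mono (x ∷ xs) f≤g = +-mono-≤ (f≤g x) (∑-mono xs f≤g)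

  ∑-+ : ∀ xs (f g : A → ℕ) → ∑[ x ← xs ] (f x + g x) ≡ ∑ xs f + ∑ xs g
  ∑-+ []       f g = refl
  ∑-+ (x ∷ xs) f g = begin
    f x + g x + ∑[ x ← xs ] (f x + g x) ≡⟨ cong (f x + g x +_) (∑-+ xs f g) ⟩
    f x + g x + (∑ xs f + ∑ xs g)       ≡⟨ +-assoc-middle (f x) (g x) (∑ xs f) (∑ xs g) ⟩
    f x + ∑ xs f + (g x + ∑ xs g)       ∎
    where
    open ≡-Reasoning
    +-assoc-middle : ∀ a b c d → a + b + (c + d) ≡ a + c + (b + d)
    +-assoc-middle = solve-∀

  ∑-const : ∀ (xs : List A) (c : ℕ) → ∑[ _ ← xs ] c ≡ length xs * c
  ∑-const []       c = refl
  ∑-const (x ∷ xs) c = cong (c +_) (∑-const xs c)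

  ∑-++ : ∀ xs ys (f : A → ℕ) → ∑ (xs ++ ys) f ≡ ∑ xs f + ∑ ys f
  ∑-++ xs ys f = trans (cong sum (map-++ f xs ys)) (sum-++ (map f xs) (map f ys))

module _ {A : Set α} {B : Set β} where

  ∑-map : ∀ (g : A → B) xs (f : B → ℕ) → ∑ (map g xs) f ≡ ∑[ x ← xs ] f (g x)
  ∑-map g xs f = cong sum (sym (map-∘ xs))

  ∑-concatMap : ∀ (g : A → List B) xs (f : B → ℕ) → ∑ (concatMap g xs) f ≡ ∑[ x ← xs ] ∑ (g x) f
  ∑-concatMap g []       f = refl
  ∑-concatMap g (x ∷ xs) f = trans (∑-++ (g x) (concatMap g xs) f) (cong (∑ (g x) f +_) (∑-concatMap g xs f))

  ∑-comm : ∀ xs ys (f : A → B → ℕ) → ∑[ x ← xs ] ∑[ y ← ys ] f x y ≡ ∑[ y ← ys ] ∑[ x ← xs ] f x y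
  ∑-comm []       ys f = sym (trans (∑-const ys 0) (*-zeroʳ (length ys)))
  ∑-comm (x ∷ xs) ys f = trans (cong (∑ ys (f x) +_) (∑-comm xs ys f)) (sym (∑-+ ys (f x) _))

count : {P : A → Set β} → (∀ x → Dec (P x)) → List A → ℕ
count P? xs = ∑[ x ← xs ] χ (P? x)

module _ {A : Set α} {P : A → Set β} (P? : ∀ x → Dec (P x)) where

  length-filter≡count : ∀ xs → length (filter P? xs) ≡ count P? xs
  length-filter≡count []       = refl
  length-filter≡count (x ∷ xs) with P? x
  ... | yes _ = cong suc (length-filter≡count xs)
  ... | no _  = length-filter≡count xs

  count≤length : ∀ xs → count P? xs ≤ length xs
  count≤length []       = z≤n
  count≤length (x ∷ xs) = +-mono-≤ (χ≤1 (P? x)) (count≤length xs)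

  count-none : ∀ xs → (∀ x → ¬ P x) → count P? xs ≡ 0
  count-none []       _    = refl
  count-none (x ∷ xs) none with P? x
  ... | yes px = contradiction px (none x)
  ... | no _   = count-none xs none

  ∑-≤-by-cases : ∀ xs {f : A → ℕ} {X Y : ℕ} → (∀ x → f x ≤ (if does (P? x) then X else Y)) →
                 ∑ xs f ≤ count P? xs * X + count (¬? ∘ P?) xs * Y
  ∑-≤-by-cases []       _ = z≤n
  ∑-≤-by-cases (x ∷ xs) {f} {X} {Y} f≤ with P? x | f≤ x
  ... | yes _ | fx≤X = begin
    f x + ∑ xs f                                      ≤⟨ +-mono-≤ fx≤X (∑-≤-by-cases xs f≤) ⟩
    X + (count P? xs * X + count (¬? ∘ P?) xs * Y)   ≡⟨ sym (+-assoc X _ _) ⟩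
    X + count P? xs * X + count (¬? ∘ P?) xs * Y     ∎
    where open ≤-Reasoning
  ... | no _  | fx≤Y = begin
    f x + ∑ xs f                                      ≤⟨ +-mono-≤ fx≤Y (∑-≤-by-cases xs f≤) ⟩
    Y + (count P? xs * X + count (¬? ∘ P?) xs * Y)   ≡⟨ +-left-comm Y (count P? xs * X) _ ⟩
    count P? xs * X + (Y + count (¬? ∘ P?) xs * Y)   ∎
    where
    open ≤-Reasoning
    +-left-comm : ∀ a b c → a + (b + c) ≡ b + (a + c)
    +-left-comm = solve-∀

  count-¬ : ∀ xs → count P? xs + count (¬? ∘ P?) xs ≡ length xs
  count-¬ xs = begin
    count P? xs + count (¬? ∘ P?) xs ≡⟨ sym (∑-+ xs _ _) ⟩
    ∑[ x ← xs ] (χ (P? x) + χ (¬? (P? x))) ≡⟨ ∑-cong xs (χ-¬ ∘ P?) ⟩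
    ∑[ _ ← xs ] 1 ≡⟨ ∑-const xs 1 ⟩
    length xs * 1 ≡⟨ *-identityʳ _ ⟩
    length xs ∎
    where open ≡-Reasoning

module _ {A : Set α} {P : A → Set β} {Q : A → Set γ} (P? : ∀ x → Dec (P x)) (Q? : ∀ x → Dec (Q x)) where

  count-mono : ∀ xs → (∀ x → P x → Q x) → count P? xs ≤ count Q? xs
  count-mono xs P⇒Q = ∑-mono xs λ x → χ-mono (P? x) (Q? x) (P⇒Q x)

  count-cong : ∀ xs → (∀ x → P x → Q x) → (∀ x → Q x → P x) → count P? xs ≡ count Q? xs
  count-cong xs P⇒Q Q⇒P = ∑-cong xs λ x → χ-cong (P? x) (Q? x) (P⇒Q x) (Q⇒P x)

  count-⊎-× : ∀ xs → count (λ x → P? x ⊎-dec Q? x) xs + count (λ x → P? x ×-dec Q? x) xs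
                     ≡ count P? xs + count Q? xs
  count-⊎-× xs = trans (sym (∑-+ xs _ _)) (trans (∑-cong xs λ x → χ-⊎-× (P? x) (Q? x)) (∑-+ xs _ _))

  count-⊎≤ : ∀ xs → count (λ x → P? x ⊎-dec Q? x) xs ≤ count P? xs + count Q? xs
  count-⊎≤ xs = ≤-trans (m≤m+n _ _) (≤-reflexive (count-⊎-× xs))

-- Words and assignments

infix 4 _≟ʷ_ _∈ʷ?_

_≟ʷ_ : ∀ {ℓ} → DecidableEquality (Vec Bool ℓ)
_≟ʷ_ = Vec.≡-dec Bool._≟_

_∈ʷ?_ : ∀ {ℓ} (w : Vec Bool ℓ) (U : List (Vec Bool ℓ)) → Dec (w ∈ˡ U)
w ∈ʷ? U = Any.any? (w ≟ʷ_) U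

length-allWords : ∀ ℓ → length (allWords ℓ) ≡ 2 ^ ℓ
length-allWords zero    = refl
length-allWords (suc ℓ) = begin
  length (allWords (suc ℓ))          ≡⟨ sym (trans (∑-const (allWords (suc ℓ)) 1) (*-identityʳ _)) ⟩
  ∑[ _ ← allWords (suc ℓ) ] 1        ≡⟨ ∑-concatMap (λ w → (false ∷ w) ∷ (true ∷ w) ∷ []) (allWords ℓ) _ ⟩
  ∑[ _ ← allWords ℓ ] 2              ≡⟨ ∑-const (allWords ℓ) 2 ⟩
  length (allWords ℓ) * 2            ≡⟨ cong (_* 2) (length-allWords ℓ) ⟩
  2 ^ ℓ * 2                          ≡⟨ *-comm (2 ^ ℓ) 2 ⟩
  2 ^ suc ℓ                          ∎
  where open ≡-Reasoning

count-allWords-≡ : ∀ ℓ (v : Vec Bool ℓ) → count (_≟ʷ v) (allWords ℓ) ≡ 1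
count-allWords-≡ zero    []      = refl
count-allWords-≡ (suc ℓ) (b ∷ v) = begin
  count (_≟ʷ b ∷ v) (allWords (suc ℓ))
    ≡⟨ ∑-concatMap (λ w → (false ∷ w) ∷ (true ∷ w) ∷ []) (allWords ℓ) _ ⟩
  ∑[ w ← allWords ℓ ] (χ (false ∷ w ≟ʷ b ∷ v) + (χ (true ∷ w ≟ʷ b ∷ v) + 0))
    ≡⟨ ∑-cong (allWords ℓ) (only-matching-head b) ⟩
  count (_≟ʷ v) (allWords ℓ)
    ≡⟨ count-allWords-≡ ℓ v ⟩
  1 ∎
  where
  open ≡-Reasoning
  only-matching-head : ∀ b w → χ (false ∷ w ≟ʷ b ∷ v) + (χ (true ∷ w ≟ʷ b ∷ v) + 0) ≡ χ (w ≟ʷ v)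
  only-matching-head false w = +-identityʳ _
  only-matching-head true  w = +-identityʳ _

count-allAssign-suc : ∀ {n ℓ} {Q : Assign (suc n) ℓ → Set β} (Q? : ∀ M → Dec (Q M)) →
  count Q? (allAssign (suc n) ℓ) ≡ ∑[ w ← allWords ℓ ] count (λ M → Q? (w ∷ M)) (allAssign n ℓ)
count-allAssign-suc {n = n} {ℓ = ℓ} Q? = begin
  count Q? (allAssign (suc n) ℓ)
    ≡⟨ ∑-concatMap (λ M → map (_∷ M) (allWords ℓ)) (allAssign n ℓ) _ ⟩
  ∑[ M ← allAssign n ℓ ] ∑ (map (_∷ M) (allWords ℓ)) (χ ∘ Q?)
    ≡⟨ ∑-cong (allAssign n ℓ) (λ M → ∑-map (_∷ M) (allWords ℓ) (χ ∘ Q?)) ⟩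
  ∑[ M ← allAssign n ℓ ] ∑[ w ← allWords ℓ ] χ (Q? (w ∷ M))
    ≡⟨ ∑-comm (allAssign n ℓ) (allWords ℓ) (λ M w → χ (Q? (w ∷ M))) ⟩
  ∑[ w ← allWords ℓ ] count (λ M → Q? (w ∷ M)) (allAssign n ℓ) ∎
  where open ≡-Reasoning

module _ {ℓ : ℕ} where

  distinct : List (Vec Bool ℓ) → ℕ
  distinct U = count (_∈ʷ? U) (allWords ℓ)

  distinct-[] : distinct [] ≡ 0
  distinct-[] = count-none (_∈ʷ? []) (allWords ℓ) (λ _ ())

  private
    ∈-∷ʳ⁻ : ∀ U {v w : Vec Bool ℓ} → v ∈ˡ U ∷ʳ w → v ∈ˡ U ⊎ v ≡ w
    ∈-∷ʳ⁻ U v∈ with ∈-++⁻ U v∈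
    ... | inj₁ v∈U        = inj₁ v∈U
    ... | inj₂ (here v≡w) = inj₂ v≡w

    ∈-∷ʳ⁺ : ∀ U {v w : Vec Bool ℓ} → v ∈ˡ U ⊎ v ≡ w → v ∈ˡ U ∷ʳ w
    ∈-∷ʳ⁺ U (inj₁ v∈U)  = ∈-++⁺ˡ v∈U
    ∈-∷ʳ⁺ U (inj₂ refl) = ∈-++⁺ʳ U (here refl)

  distinct-∷ʳ-∈ : ∀ U {w} → w ∈ˡ U → distinct (U ∷ʳ w) ≡ distinct U
  distinct-∷ʳ-∈ U {w} w∈U = count-cong (_∈ʷ? U ∷ʳ w) (_∈ʷ? U) (allWords ℓ)
    (λ _ v∈ → [ id , (λ { refl → w∈U }) ] (∈-∷ʳ⁻ U v∈))
    (λ _ → ∈-++⁺ˡ)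

  distinct-∷ʳ-∉ : ∀ U {w} → w ∉ˡ U → distinct (U ∷ʳ w) ≡ suc (distinct U)
  distinct-∷ʳ-∉ U {w} w∉U = begin
    distinct (U ∷ʳ w)
      ≡⟨ sym (+-identityʳ _) ⟩
    distinct (U ∷ʳ w) + 0
      ≡⟨ cong₂ _+_ (count-cong (_∈ʷ? U ∷ʳ w) (λ v → v ∈ʷ? U ⊎-dec v ≟ʷ w) (allWords ℓ) (λ _ → ∈-∷ʳ⁻ U) (λ _ → ∈-∷ʳ⁺ U))
                   (sym (count-none (λ v → v ∈ʷ? U ×-dec v ≟ʷ w) (allWords ℓ) λ { _ (v∈U , refl) → w∉U v∈U })) ⟩
    count (λ v → v ∈ʷ? U ⊎-dec v ≟ʷ w) (allWords ℓ) + count (λ v → v ∈ʷ? U ×-dec v ≟ʷ w) (allWords ℓ)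
      ≡⟨ count-⊎-× (_∈ʷ? U) (_≟ʷ w) (allWords ℓ) ⟩
    distinct U + count (_≟ʷ w) (allWords ℓ)
      ≡⟨ cong (distinct U +_) (count-allWords-≡ ℓ w) ⟩
    distinct U + 1
      ≡⟨ +-comm (distinct U) 1 ⟩
    suc (distinct U) ∎
    where open ≡-Reasoning

  distinct-++ : ∀ U R → distinct U ≤ distinct (U ++ R)
  distinct-++ U R = count-mono (_∈ʷ? U) (_∈ʷ? U ++ R) (allWords ℓ) (λ _ → ∈-++⁺ˡ)

  distinct≤length : ∀ U → distinct U ≤ length U
  distinct≤length []      = ≤-reflexive distinct-[]
  distinct≤length (d ∷ D) = begin
    distinct (d ∷ D)
      ≤⟨ count-mono (_∈ʷ? d ∷ D) (λ v → v ≟ʷ d ⊎-dec v ∈ʷ? D) (allWords ℓ) (λ _ → toSum) ⟩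
    count (λ v → v ≟ʷ d ⊎-dec v ∈ʷ? D) (allWords ℓ)
      ≤⟨ count-⊎≤ (_≟ʷ d) (_∈ʷ? D) (allWords ℓ) ⟩
    count (_≟ʷ d) (allWords ℓ) + distinct D
      ≡⟨ cong (_+ distinct D) (count-allWords-≡ ℓ d) ⟩
    suc (distinct D)
      ≤⟨ s≤s (distinct≤length D) ⟩
    suc (length D) ∎
    where open ≤-Reasoning

-- Words of a node set and the boundary

wordsOf : ∀ {n ℓ} → Subset n → Assign n ℓ → List (Vec Bool ℓ)
wordsOf []          []      = []
wordsOf (true ∷ A)  (w ∷ M) = w ∷ wordsOf A M
wordsOf (false ∷ A) (w ∷ M) = wordsOf A M

∈-wordsOf⁻ : ∀ {n ℓ} (A : Subset n) (M : Assign n ℓ) {w} → w ∈ˡ wordsOf A M → ∃[ x ] x ∈ A × lookup M x ≡ w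
∈-wordsOf⁻ []          []      ()
∈-wordsOf⁻ (true ∷ A)  (v ∷ M) (here refl) = zero , here , refl
∈-wordsOf⁻ (true ∷ A)  (v ∷ M) (there w∈)  with ∈-wordsOf⁻ A M w∈
... | x , x∈A , x↦w = suc x , there x∈A , x↦w
∈-wordsOf⁻ (false ∷ A) (v ∷ M) w∈          with ∈-wordsOf⁻ A M w∈
... | x , x∈A , x↦w = suc x , there x∈A , x↦w

∣-∣-between : ∀ {x z y} → x < z → z < y → ∣ z - y ∣ < ∣ x - y ∣ × ∣ x - z ∣ < ∣ x - y ∣
∣-∣-between {x} {z} {y} x<z z<y =
    subst₂ _<_ (sym (m≤n⇒∣m-n∣≡n∸m (<⇒≤ z<y))) (sym ∣x-y∣≡y∸x) (∸-monoʳ-< x<z (<⇒≤ z<y))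
  , subst₂ _<_ (sym (m≤n⇒∣m-n∣≡n∸m (<⇒≤ x<z))) (sym ∣x-y∣≡y∸x) (∸-monoˡ-< z<y (<⇒≤ x<z))
  where ∣x-y∣≡y∸x = m≤n⇒∣m-n∣≡n∸m (<⇒≤ (<-trans x<z z<y))

StrictlyBetween⇒closer : ∀ {n} {x z y : Fin n} → StrictlyBetween x z y →
  ∣ toℕ z - toℕ y ∣ < ∣ toℕ x - toℕ y ∣ × ∣ toℕ x - toℕ z ∣ < ∣ toℕ x - toℕ y ∣
StrictlyBetween⇒closer (inj₁ (x<z , z<y)) = ∣-∣-between x<z z<y
StrictlyBetween⇒closer {x = x} {z} {y} (inj₂ (y<z , z<x)) with ∣-∣-between y<z z<x
... | ∣z-x∣<∣y-x∣ , ∣y-z∣<∣y-x∣ =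
    subst₂ _<_ (∣-∣-comm (toℕ y) (toℕ z)) ∣y-x∣≡∣x-y∣ ∣y-z∣<∣y-x∣
  , subst₂ _<_ (∣-∣-comm (toℕ z) (toℕ x)) ∣y-x∣≡∣x-y∣ ∣z-x∣<∣y-x∣
  where ∣y-x∣≡∣x-y∣ = ∣-∣-comm (toℕ y) (toℕ x)

module _ {n ℓ} (A : Subset n) (M : Assign n ℓ) where

  mixedWord⇒boundaryNode : ∀ {a b w} → Acc _<_ ∣ toℕ a - toℕ b ∣ → a ∈ A → b ∉ A →
    lookup M a ≡ w → lookup M b ≡ w → ∃[ y ] InBoundary A M y × lookup M y ≡ w
  mixedWord⇒boundaryNode {a} {b} {w} (acc closer) a∈A b∉A a↦w b↦w
    with any? (λ z → between? a z b ×-dec lookup M z ≟ʷ w)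
  ... | no nothingBetween = b , (b∉A , a , a∈A , a~b) , b↦w
    where
    a~b : Edge M a b
    a~b = (λ { refl → b∉A a∈A })
        , trans a↦w (sym b↦w)
        , λ z a<z<b z↦a → nothingBetween (z , a<z<b , trans z↦a a↦w)
  ... | yes (z , a<z<b , z↦w) with z ∈? A
  ...   | yes z∈A = mixedWord⇒boundaryNode (closer (proj₁ (StrictlyBetween⇒closer a<z<b))) z∈A b∉A z↦w b↦w
  ...   | no  z∉A = mixedWord⇒boundaryNode (closer (proj₂ (StrictlyBetween⇒closer a<z<b))) a∈A z∉A a↦w z↦w

  boundaryWords : List (Vec Bool ℓ)
  boundaryWords = map (lookup M) (filter (inBoundary? A M) (allFin n))

  shared⇒boundaryWord : ∀ {w} → w ∈ˡ wordsOf A M → w ∈ˡ wordsOf (∁ A) M → w ∈ˡ boundaryWords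
  shared⇒boundaryWord w∈A w∈∁A with ∈-wordsOf⁻ A M w∈A | ∈-wordsOf⁻ (∁ A) M w∈∁A
  ... | a , a∈A , a↦w | b , b∈∁A , b↦w
    with mixedWord⇒boundaryNode (<-wellFounded _) a∈A (x∈∁p⇒x∉p b∈∁A) a↦w b↦w
  ... | y , y∈δA , y↦w =
    subst (_∈ˡ boundaryWords) y↦w (∈-map⁺ (lookup M) (∈-filter⁺ (inBoundary? A M) (∈-allFin y) y∈δA))

  distinct-wordsOf+distinct-wordsOf∁≤ :
    distinct (wordsOf A M) + distinct (wordsOf (∁ A) M) ≤ 2 ^ ℓ + boundarySize A M
  distinct-wordsOf+distinct-wordsOf∁≤ = begin
    distinct (wordsOf A M) + distinct (wordsOf (∁ A) M)
      ≡⟨ sym (count-⊎-× inA? inB? (allWords ℓ)) ⟩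
    count inA⊎inB? (allWords ℓ) + count inA×inB? (allWords ℓ)
      ≤⟨ +-mono-≤ (≤-trans (count≤length inA⊎inB? (allWords ℓ)) (≤-reflexive (length-allWords ℓ)))
                  (count-mono inA×inB? (_∈ʷ? boundaryWords) (allWords ℓ) λ _ → uncurry shared⇒boundaryWord) ⟩
    2 ^ ℓ + distinct boundaryWords
      ≤⟨ +-monoʳ-≤ (2 ^ ℓ) (distinct≤length boundaryWords) ⟩
    2 ^ ℓ + length boundaryWords
      ≡⟨ cong (2 ^ ℓ +_) (length-map (lookup M) (filter (inBoundary? A M) (allFin n))) ⟩
    2 ^ ℓ + boundarySize A M ∎
    where
    open ≤-Reasoning
    inA? = _∈ʷ? wordsOf A M
    inB? = _∈ʷ? wordsOf (∁ A) M
    inA⊎inB? = λ v → inA? v ⊎-dec inB? v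
    inA×inB? = λ v → inA? v ×-dec inB? v

-- Assignments in which few words occur

[1+k]*[1+n]C[1+k]≡[1+n]*nCk : ∀ n k → suc k * (suc n C suc k) ≡ suc n * (n C k)
[1+k]*[1+n]C[1+k]≡[1+n]*nCk zero    zero    = refl
[1+k]*[1+n]C[1+k]≡[1+n]*nCk zero    (suc k)
  rewrite k>n⇒nCk≡0 {1} {suc (suc k)} (s≤s (s≤s z≤n)) | k>n⇒nCk≡0 {0} {suc k} (s≤s z≤n) = *-zeroʳ (suc (suc k))
[1+k]*[1+n]C[1+k]≡[1+n]*nCk (suc n) zero
  rewrite nC1≡n (suc (suc n)) = trans (+-identityʳ _) (sym (*-identityʳ _))
[1+k]*[1+n]C[1+k]≡[1+n]*nCk (suc n) (suc k) = begin
  suc (suc k) * (suc (suc n) C suc (suc k))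
    ≡⟨ cong (suc (suc k) *_) (sym (nCk+nC[k+1]≡[n+1]C[k+1] (suc n) (suc k))) ⟩
  suc (suc k) * (x + y)
    ≡⟨ distribute k x y ⟩
  x + (suc k * x + suc (suc k) * y)
    ≡⟨ cong₂ (λ s t → x + (s + t)) ([1+k]*[1+n]C[1+k]≡[1+n]*nCk n k) ([1+k]*[1+n]C[1+k]≡[1+n]*nCk n (suc k)) ⟩
  x + (suc n * (n C k) + suc n * (n C suc k))
    ≡⟨ cong (x +_) (sym (*-distribˡ-+ (suc n) (n C k) (n C suc k))) ⟩
  x + suc n * (n C k + n C suc k)
    ≡⟨ cong (λ z → x + suc n * z) (nCk+nC[k+1]≡[n+1]C[k+1] n k) ⟩
  suc (suc n) * x ∎
  where
  open ≡-Reasoning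
  x = suc n C suc k
  y = suc n C suc (suc k)
  distribute : ∀ b x y → suc (suc b) * (x + y) ≡ x + (suc b * x + suc (suc b) * y)
  distribute = solve-∀

k≤n⇒nCk>0 : ∀ {n k} → k ≤ n → n C k > 0
k≤n⇒nCk>0 {n}     {zero}  _         = ≤-refl
k≤n⇒nCk>0 {suc n} {suc k} (s≤s k≤n) =
  ≤-trans (k≤n⇒nCk>0 k≤n) (≤-trans (m≤m+n _ _) (≤-reflexive (nCk+nC[k+1]≡[n+1]C[k+1] n k)))

module _ {ℓ : ℕ} (k : ℕ) where

  fewWords? : ∀ {n} (U : List (Vec Bool ℓ)) (A : Subset n) (M : Assign n ℓ) → Dec (distinct (U ++ wordsOf A M) ≤ k)
  fewWords? U A M = distinct (U ++ wordsOf A M) ≤? k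

  private
    count-fewWords-∷ : ∀ {n} U (A : Subset n) →
      count (fewWords? U (true ∷ A)) (allAssign (suc n) ℓ)
        ≡ ∑[ w ← allWords ℓ ] count (fewWords? (U ∷ʳ w) A) (allAssign n ℓ)
    count-fewWords-∷ {n} U A = trans (count-allAssign-suc (fewWords? U (true ∷ A))) (∑-cong (allWords ℓ) λ w →
      let reassoc = λ M → cong (λ L → distinct L ≤ k) (++-assoc U (w ∷ []) (wordsOf A M)) in
      count-cong (λ M → fewWords? U (true ∷ A) (w ∷ M)) (fewWords? (U ∷ʳ w) A) (allAssign n ℓ)
        (λ M → subst id (sym (reassoc M))) (λ M → subst id (reassoc M)))

    count-∉ : ∀ U {a} → distinct U + a ≡ 2 ^ ℓ → count (¬? ∘ (_∈ʷ? U)) (allWords ℓ) ≡ a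
    count-∉ U u+a≡N = +-cancelˡ-≡ (distinct U) _ _
      (trans (trans (count-¬ (_∈ʷ? U) (allWords ℓ)) (length-allWords ℓ)) (sym u+a≡N))

  -- U lists the words used so far, a words are still unused and b more may be used. A node of A
  -- takes one of the distinct U old words or one of the a new ones, and a·C(a−1, b−1) = b·C(a, b)
  -- makes the total k·C(a, b).
  count-fewWords : ∀ {n} (A : Subset n) U {a b} → b ≤ a → distinct U + a ≡ 2 ^ ℓ → distinct U + b ≡ k →
    count (fewWords? U A) (allAssign n ℓ) ≤ (a C b) * (k ^ ∣ A ∣ * (2 ^ ℓ) ^ ∣ ∁ A ∣)
  count-fewWords [] U {a} {b} b≤a _ _ = begin
    count (fewWords? U []) (allAssign zero ℓ) ≤⟨ count≤length (fewWords? U []) (allAssign zero ℓ) ⟩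
    1                                         ≤⟨ k≤n⇒nCk>0 b≤a ⟩
    a C b                                     ≡⟨ sym (*-identityʳ (a C b)) ⟩
    (a C b) * 1                               ∎
    where open ≤-Reasoning
  count-fewWords {suc n} (false ∷ A) U {a} {b} b≤a u+a≡N u+b≡k = begin
    count (fewWords? U (false ∷ A)) (allAssign (suc n) ℓ)
      ≡⟨ count-allAssign-suc (fewWords? U (false ∷ A)) ⟩
    ∑[ _ ← allWords ℓ ] count (fewWords? U A) (allAssign n ℓ)
      ≤⟨ ∑-mono (allWords ℓ) (λ _ → count-fewWords A U b≤a u+a≡N u+b≡k) ⟩
    ∑[ _ ← allWords ℓ ] ((a C b) * ways)
      ≡⟨ ∑-const (allWords ℓ) _ ⟩
    length (allWords ℓ) * ((a C b) * ways)
      ≡⟨ cong (_* ((a C b) * ways)) (length-allWords ℓ) ⟩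
    2 ^ ℓ * ((a C b) * (k ^ ∣ A ∣ * (2 ^ ℓ) ^ ∣ ∁ A ∣))
      ≡⟨ reorder (2 ^ ℓ) (a C b) (k ^ ∣ A ∣) ((2 ^ ℓ) ^ ∣ ∁ A ∣) ⟩
    (a C b) * (k ^ ∣ A ∣ * (2 ^ ℓ * (2 ^ ℓ) ^ ∣ ∁ A ∣)) ∎
    where
    open ≤-Reasoning
    ways = k ^ ∣ A ∣ * (2 ^ ℓ) ^ ∣ ∁ A ∣
    reorder : ∀ N c x y → N * (c * (x * y)) ≡ c * (x * (N * y))
    reorder = solve-∀
  count-fewWords {suc n} (true ∷ A) U {a} {zero} _ u+a≡N u≡k = begin
    count (fewWords? U (true ∷ A)) (allAssign (suc n) ℓ)
      ≡⟨ count-fewWords-∷ U A ⟩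
    ∑[ w ← allWords ℓ ] count (fewWords? (U ∷ʳ w) A) (allAssign n ℓ)
      ≤⟨ ∑-≤-by-cases (_∈ʷ? U) (allWords ℓ) byFirstWord ⟩
    distinct U * ((a C 0) * ways) + count (¬? ∘ (_∈ʷ? U)) (allWords ℓ) * 0
      ≡⟨ cong₂ (λ u c → u * ((a C 0) * ways) + c) (trans (sym (+-identityʳ _)) u≡k) (*-zeroʳ (count (¬? ∘ (_∈ʷ? U)) (allWords ℓ))) ⟩
    k * ((a C 0) * ways) + 0
      ≡⟨ reorder k (a C 0) (k ^ ∣ A ∣) ((2 ^ ℓ) ^ ∣ ∁ A ∣) ⟩
    (a C 0) * (k * k ^ ∣ A ∣ * (2 ^ ℓ) ^ ∣ ∁ A ∣) ∎
    where
    open ≤-Reasoning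
    ways = k ^ ∣ A ∣ * (2 ^ ℓ) ^ ∣ ∁ A ∣
    reorder : ∀ k c x y → k * (c * (x * y)) + 0 ≡ c * (k * x * y)
    reorder = solve-∀
    byFirstWord : ∀ w → count (fewWords? (U ∷ʳ w) A) (allAssign n ℓ) ≤ (if does (w ∈ʷ? U) then (a C 0) * ways else 0)
    byFirstWord w with w ∈ʷ? U
    ... | yes w∈U = count-fewWords A (U ∷ʳ w) z≤n
          (trans (cong (_+ a) (distinct-∷ʳ-∈ U w∈U)) u+a≡N) (trans (cong (_+ 0) (distinct-∷ʳ-∈ U w∈U)) u≡k)
    ... | no  w∉U = ≤-reflexive (count-none (fewWords? (U ∷ʳ w) A) (allAssign n ℓ) λ M few →
          <-irrefl refl (begin-strict
            k                                     ≡⟨ trans (sym u≡k) (+-identityʳ _) ⟩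
            distinct U                            <⟨ ≤-reflexive (sym (distinct-∷ʳ-∉ U w∉U)) ⟩
            distinct (U ∷ʳ w)                     ≤⟨ distinct-++ (U ∷ʳ w) (wordsOf A M) ⟩
            distinct ((U ∷ʳ w) ++ wordsOf A M)    ≤⟨ few ⟩
            k                                     ∎))
  count-fewWords {suc n} (true ∷ A) U {suc a} {suc b} (s≤s b≤a) u+[1+a]≡N u+[1+b]≡k = begin
    count (fewWords? U (true ∷ A)) (allAssign (suc n) ℓ)
      ≡⟨ count-fewWords-∷ U A ⟩
    ∑[ w ← allWords ℓ ] count (fewWords? (U ∷ʳ w) A) (allAssign n ℓ)
      ≤⟨ ∑-≤-by-cases (_∈ʷ? U) (allWords ℓ) byFirstWord ⟩
    u * (C₊ * ways) + count (¬? ∘ (_∈ʷ? U)) (allWords ℓ) * ((a C b) * ways)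
      ≡⟨ cong (λ c → u * (C₊ * ways) + c * ((a C b) * ways)) (count-∉ U u+[1+a]≡N) ⟩
    u * (C₊ * ways) + suc a * ((a C b) * ways)
      ≡⟨ cong (u * (C₊ * ways) +_) (trans (sym (*-assoc (suc a) (a C b) ways)) (cong (_* ways) (sym ([1+k]*[1+n]C[1+k]≡[1+n]*nCk a b)))) ⟩
    u * (C₊ * ways) + suc b * C₊ * ways
      ≡⟨ factor u (suc b) C₊ ways ⟩
    (u + suc b) * (C₊ * ways)
      ≡⟨ cong (_* (C₊ * ways)) u+[1+b]≡k ⟩
    k * (C₊ * (k ^ ∣ A ∣ * (2 ^ ℓ) ^ ∣ ∁ A ∣))
      ≡⟨ reorder k C₊ (k ^ ∣ A ∣) ((2 ^ ℓ) ^ ∣ ∁ A ∣) ⟩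
    C₊ * (k * k ^ ∣ A ∣ * (2 ^ ℓ) ^ ∣ ∁ A ∣) ∎
    where
    open ≤-Reasoning
    u = distinct U
    ways = k ^ ∣ A ∣ * (2 ^ ℓ) ^ ∣ ∁ A ∣
    C₊ = suc a C suc b
    factor : ∀ u b c w → u * (c * w) + b * c * w ≡ (u + b) * (c * w)
    factor = solve-∀
    reorder : ∀ k c x y → k * (c * (x * y)) ≡ c * (k * x * y)
    reorder = solve-∀
    byFirstWord : ∀ w → count (fewWords? (U ∷ʳ w) A) (allAssign n ℓ) ≤ (if does (w ∈ʷ? U) then C₊ * ways else (a C b) * ways)
    byFirstWord w with w ∈ʷ? U
    ... | yes w∈U = count-fewWords A (U ∷ʳ w) (s≤s b≤a)
          (trans (cong (_+ suc a) (distinct-∷ʳ-∈ U w∈U)) u+[1+a]≡N)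
          (trans (cong (_+ suc b) (distinct-∷ʳ-∈ U w∈U)) u+[1+b]≡k)
    ... | no  w∉U = count-fewWords A (U ∷ʳ w) b≤a
          (trans (cong (_+ a) (distinct-∷ʳ-∉ U w∉U)) (trans (sym (+-suc u a)) u+[1+a]≡N))
          (trans (cong (_+ b) (distinct-∷ʳ-∉ U w∉U)) (trans (sym (+-suc u b)) u+[1+b]≡k))

-- Arithmetic

m<[1+m/n]*n : ∀ m n .{{_ : NonZero n}} → m < suc (m / n) * n
m<[1+m/n]*n m n = begin-strict
  m                  ≡⟨ m≡m%n+[m/n]*n m n ⟩
  m % n + m / n * n  <⟨ +-monoˡ-< (m / n * n) (m%n<n m n) ⟩
  suc (m / n) * n    ∎
  where open ≤-Reasoning

either≤2N/3 : ∀ N δ x y → 3 * δ ≤ N → x + y ≤ N + δ → x ≤ 2 * N / 3 ⊎ y ≤ 2 * N / 3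
either≤2N/3 N δ x y 3δ≤N x+y≤N+δ with x ≤? 2 * N / 3 | y ≤? 2 * N / 3
... | yes x≤ | _      = inj₁ x≤
... | no _   | yes y≤ = inj₂ y≤
... | no x≰  | no y≰  = contradiction (begin-strict
  2 * (suc k * 3)      ≡⟨ reorder k ⟩
  3 * (suc k + suc k)  ≤⟨ *-monoʳ-≤ 3 (≤-trans (+-mono-≤ (≰⇒> x≰) (≰⇒> y≰)) x+y≤N+δ) ⟩
  3 * (N + δ)          ≡⟨ *-distribˡ-+ 3 N δ ⟩
  3 * N + 3 * δ        ≤⟨ +-monoʳ-≤ (3 * N) 3δ≤N ⟩
  3 * N + N            ≡⟨ merge N ⟩
  2 * (2 * N)          <⟨ *-monoʳ-< 2 (m<[1+m/n]*n (2 * N) 3) ⟩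
  2 * (suc k * 3)      ∎) (<-irrefl refl)
  where
  open ≤-Reasoning
  k = 2 * N / 3
  reorder : ∀ k → 2 * (suc k * 3) ≡ 3 * (suc k + suc k)
  reorder = solve-∀
  merge : ∀ N → 3 * N + N ≡ 2 * (2 * N)
  merge = solve-∀

3∤2^n : ∀ n → ¬ 3 ∣ 2 ^ n
3∤2^n zero    3∣1   = contradiction (∣1⇒≡1 3∣1) λ ()
3∤2^n (suc n) 3∣2^n = 3∤2^n n (coprime-divisor 3-coprime-2 3∣2^n)
  where
  3-coprime-2 : Coprime 3 2
  3-coprime-2 = gcd≡1⇒coprime refl

[2*2^ℓ/3]*3<2*2^ℓ : ∀ ℓ → 2 * 2 ^ ℓ / 3 * 3 < 2 * 2 ^ ℓ
[2*2^ℓ/3]*3<2*2^ℓ ℓ = ≤∧≢⇒< (m/n*n≤m (2 * 2 ^ ℓ) 3) λ eq → 3∤2^n (suc ℓ) (divides (2 * 2 ^ ℓ / 3) (sym eq))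

^-distribʳ-* : ∀ m n o → (m * n) ^ o ≡ m ^ o * n ^ o
^-distribʳ-* m n zero    = refl
^-distribʳ-* m n (suc o) = trans (cong (m * n *_) (^-distribʳ-* m n o)) (interchange m n (m ^ o) (n ^ o))
  where
  interchange : ∀ a b c d → a * b * (c * d) ≡ a * c * (b * d)
  interchange = solve-∀

m*3<2*n⇒m<n : ∀ {m n} → m * 3 < 2 * n → m < n
m*3<2*n⇒m<n {m} {n} m*3<2*n = *-cancelʳ-< 3 m n (<-≤-trans m*3<2*n (≤-trans (*-monoˡ-≤ n (n≤1+n 2)) (≤-reflexive (*-comm 3 n))))

module _ {k N : ℕ} (k*3<2*N : k * 3 < 2 * N) where

  private
    k<N : k < N
    k<N = m*3<2*n⇒m<n k*3<2*N

    instance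
      N≢0 : NonZero N
      N≢0 = >-nonZero (≤-<-trans z≤n k<N)

    powers< : ∀ m d → 0 < m + (m + d) → (k * 3) ^ m * k ^ d < (2 * N) ^ m * N ^ d
    powers< zero    (suc d) _ = *-monoʳ-< 1 (^-monoˡ-< (suc d) k<N)
    powers< (suc m) d       _ = ≤-<-trans (*-monoʳ-≤ ((k * 3) ^ suc m) (^-monoˡ-≤ d (<⇒≤ k<N)))
                                          (*-monoˡ-< (N ^ d) {{m^n≢0 N d}} (^-monoˡ-< (suc m) k*3<2*N))

    term≤ : ∀ m e → k ^ m * N ^ e * 3 ^ m ≤ 2 ^ m * N ^ (m + e)
    term≤ m e = begin
      k ^ m * N ^ e * 3 ^ m    ≡⟨ swap₂₃ (k ^ m) (N ^ e) (3 ^ m) ⟩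
      k ^ m * 3 ^ m * N ^ e    ≡⟨ cong (_* N ^ e) (sym (^-distribʳ-* k 3 m)) ⟩
      (k * 3) ^ m * N ^ e      ≤⟨ *-monoˡ-≤ (N ^ e) (^-monoˡ-≤ m (<⇒≤ k*3<2*N)) ⟩
      (2 * N) ^ m * N ^ e      ≡⟨ cong (_* N ^ e) (^-distribʳ-* 2 N m) ⟩
      2 ^ m * N ^ m * N ^ e    ≡⟨ *-assoc (2 ^ m) (N ^ m) (N ^ e) ⟩
      2 ^ m * (N ^ m * N ^ e)  ≡⟨ cong (2 ^ m *_) (sym (^-distribˡ-+-* N m e)) ⟩
      2 ^ m * N ^ (m + e)      ∎
      where
      open ≤-Reasoning
      swap₂₃ : ∀ a b c → a * b * c ≡ a * c * b
      swap₂₃ = solve-∀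

    term< : ∀ m d → 0 < m + (m + d) → k ^ (m + d) * N ^ m * 3 ^ m < 2 ^ m * N ^ (m + (m + d))
    term< m d 0<m+m' = begin-strict
      k ^ (m + d) * N ^ m * 3 ^ m          ≡⟨ cong (λ z → z * N ^ m * 3 ^ m) (^-distribˡ-+-* k m d) ⟩
      k ^ m * k ^ d * N ^ m * 3 ^ m        ≡⟨ regroup (k ^ m) (k ^ d) (N ^ m) (3 ^ m) ⟩
      k ^ m * 3 ^ m * k ^ d * N ^ m        ≡⟨ cong (λ z → z * k ^ d * N ^ m) (sym (^-distribʳ-* k 3 m)) ⟩
      (k * 3) ^ m * k ^ d * N ^ m          <⟨ *-monoˡ-< (N ^ m) {{m^n≢0 N m}} (powers< m d 0<m+m') ⟩
      (2 * N) ^ m * N ^ d * N ^ m          ≡⟨ cong (λ z → z * N ^ d * N ^ m) (^-distribʳ-* 2 N m) ⟩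
      2 ^ m * N ^ m * N ^ d * N ^ m        ≡⟨ regroup′ (2 ^ m) (N ^ m) (N ^ d) ⟩
      2 ^ m * (N ^ m * (N ^ m * N ^ d))    ≡⟨ cong (λ z → 2 ^ m * (N ^ m * z)) (sym (^-distribˡ-+-* N m d)) ⟩
      2 ^ m * (N ^ m * N ^ (m + d))        ≡⟨ cong (2 ^ m *_) (sym (^-distribˡ-+-* N m (m + d))) ⟩
      2 ^ m * N ^ (m + (m + d))            ∎
      where
      open ≤-Reasoning
      regroup : ∀ a b c e → a * b * c * e ≡ a * e * b * c
      regroup = solve-∀
      regroup′ : ∀ t a b → t * a * b * a ≡ t * (a * (a * b))
      regroup′ = solve-∀

  weighted-sum< : ∀ {m m'} → m ≤ m' → 0 < m + m' →
    (k ^ m * N ^ m' + k ^ m' * N ^ m) * 3 ^ m < 2 * 2 ^ m * N ^ (m + m')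
  weighted-sum< {m} m≤m' 0<m+m' with m≤n⇒∃[o]m+o≡n m≤m'
  ... | d , refl = begin-strict
    (k ^ m * N ^ (m + d) + k ^ (m + d) * N ^ m) * 3 ^ m
      ≡⟨ *-distribʳ-+ (3 ^ m) (k ^ m * N ^ (m + d)) (k ^ (m + d) * N ^ m) ⟩
    k ^ m * N ^ (m + d) * 3 ^ m + k ^ (m + d) * N ^ m * 3 ^ m
      <⟨ +-mono-≤-< (term≤ m (m + d)) (term< m d 0<m+m') ⟩
    2 ^ m * N ^ (m + (m + d)) + 2 ^ m * N ^ (m + (m + d))
      ≡⟨ double (2 ^ m) (N ^ (m + (m + d))) ⟩
    2 * 2 ^ m * N ^ (m + (m + d)) ∎
    where
    open ≤-Reasoning
    double : ∀ t q → t * q + t * q ≡ 2 * t * q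
    double = solve-∀

[2*2^ℓ/3]≤2^ℓ : ∀ ℓ → 2 * 2 ^ ℓ / 3 ≤ 2 ^ ℓ
[2*2^ℓ/3]≤2^ℓ ℓ = <⇒≤ (m*3<2*n⇒m<n ([2*2^ℓ/3]*3<2*2^ℓ ℓ))

∁-involutive : ∀ {n} (A : Subset n) → ∁ (∁ A) ≡ A
∁-involutive A = trans (sym (Vec.map-∘ not not A)) (trans (Vec.map-cong Bool.not-involutive A) (Vec.map-id A))

∣p∣+∣∁p∣≡n : ∀ {n} (A : Subset n) → ∣ A ∣ + ∣ ∁ A ∣ ≡ n
∣p∣+∣∁p∣≡n A = trans (cong (∣ A ∣ +_) (∣∁p∣≡n∸∣p∣ A)) (m+[n∸m]≡n (∣p∣≤n A))

badCount≤ : ∀ {n} ℓ (A : Subset n) → let N = 2 ^ ℓ; k = 2 * 2 ^ ℓ / 3 in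
  badCount n ℓ A ≤ (N C k) * (k ^ ∣ A ∣ * N ^ ∣ ∁ A ∣ + k ^ ∣ ∁ A ∣ * N ^ ∣ A ∣)
badCount≤ {n} ℓ A = begin
  badCount n ℓ A
    ≡⟨ length-filter≡count bad? (allAssign n ℓ) ⟩
  count bad? (allAssign n ℓ)
    ≤⟨ count-mono bad? fewA⊎fewB? (allAssign n ℓ) (λ M bad →
         either≤2N/3 N (boundarySize A M) _ _ bad (distinct-wordsOf+distinct-wordsOf∁≤ A M)) ⟩
  count fewA⊎fewB? (allAssign n ℓ)
    ≤⟨ count-⊎≤ (fewWords? k [] A) (fewWords? k [] (∁ A)) (allAssign n ℓ) ⟩
  count (fewWords? k [] A) (allAssign n ℓ) + count (fewWords? k [] (∁ A)) (allAssign n ℓ)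
    ≤⟨ +-mono-≤ (count-fewWords-[] A) count-fewWords-∁ ⟩
  (N C k) * (k ^ ∣ A ∣ * N ^ ∣ ∁ A ∣) + (N C k) * (k ^ ∣ ∁ A ∣ * N ^ ∣ A ∣)
    ≡⟨ sym (*-distribˡ-+ (N C k) _ _) ⟩
  (N C k) * (k ^ ∣ A ∣ * N ^ ∣ ∁ A ∣ + k ^ ∣ ∁ A ∣ * N ^ ∣ A ∣) ∎
  where
  open ≤-Reasoning
  N = 2 ^ ℓ
  k = 2 * 2 ^ ℓ / 3
  bad? = λ M → 3 * boundarySize A M ≤? N
  fewA⊎fewB? = λ M → fewWords? k [] A M ⊎-dec fewWords? k [] (∁ A) M
  count-fewWords-[] : ∀ B → count (fewWords? k [] B) (allAssign n ℓ) ≤ (N C k) * (k ^ ∣ B ∣ * N ^ ∣ ∁ B ∣)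
  count-fewWords-[] B = count-fewWords k B [] ([2*2^ℓ/3]≤2^ℓ ℓ) (cong (_+ N) (distinct-[] {ℓ})) (cong (_+ k) (distinct-[] {ℓ}))
  count-fewWords-∁ : count (fewWords? k [] (∁ A)) (allAssign n ℓ) ≤ (N C k) * (k ^ ∣ ∁ A ∣ * N ^ ∣ A ∣)
  count-fewWords-∁ = subst (λ B → count (fewWords? k [] (∁ A)) (allAssign n ℓ) ≤ (N C k) * (k ^ ∣ ∁ A ∣ * N ^ ∣ B ∣))
                           (∁-involutive A) (count-fewWords-[] (∁ A))

∣p∣≤∣∁p∣ : ∀ {n} (A : Subset n) → 2 * ∣ A ∣ ≤ n → ∣ A ∣ ≤ ∣ ∁ A ∣
∣p∣≤∣∁p∣ A 2m≤n = +-cancelˡ-≤ m m m' (subst₂ _≤_ (cong (m +_) (+-identityʳ m)) (sym (∣p∣+∣∁p∣≡n A)) 2m≤n)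
  where
  m = ∣ A ∣
  m' = ∣ ∁ A ∣

lemma8 : (n : ℕ) (A : Subset n) (ℓ : ℕ) → 2 * ∣ A ∣ ≤ n →
    badCount n ℓ A * 3 ^ ∣ A ∣ < 2 * ((2 ^ ℓ) C ((2 * 2 ^ ℓ) / 3)) * 2 ^ ∣ A ∣ * 2 ^ (n * ℓ)
lemma8 zero [] ℓ _ = begin-strict
  badCount zero ℓ [] * 1  ≤⟨ *-monoˡ-≤ 1 (length-filter (λ M → 3 * boundarySize [] M ≤? 2 ^ ℓ) (allAssign zero ℓ)) ⟩
  1                       <⟨ *-monoʳ-≤ 2 (k≤n⇒nCk>0 ([2*2^ℓ/3]≤2^ℓ ℓ)) ⟩
  2 * c                   ≡⟨ sym (trans (*-identityʳ _) (*-identityʳ _)) ⟩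
  2 * c * 1 * 1           ∎
  where
  open ≤-Reasoning
  c = (2 ^ ℓ) C (2 * 2 ^ ℓ / 3)
lemma8 n@(suc _) A ℓ 2m≤n = begin-strict
  badCount n ℓ A * 3 ^ m
    ≤⟨ *-monoˡ-≤ (3 ^ m) (badCount≤ ℓ A) ⟩
  c * (k ^ m * N ^ m' + k ^ m' * N ^ m) * 3 ^ m
    ≡⟨ *-assoc c _ (3 ^ m) ⟩
  c * ((k ^ m * N ^ m' + k ^ m' * N ^ m) * 3 ^ m)
    <⟨ *-monoʳ-< c (weighted-sum< ([2*2^ℓ/3]*3<2*2^ℓ ℓ) (∣p∣≤∣∁p∣ A 2m≤n) (subst (0 <_) (sym m+m'≡n) z<s)) ⟩
  c * (2 * 2 ^ m * N ^ (m + m'))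
    ≡⟨ reorder c (2 ^ m) (N ^ (m + m')) ⟩
  2 * c * 2 ^ m * N ^ (m + m')
    ≡⟨ cong (2 * c * 2 ^ m *_) (trans (cong (N ^_) m+m'≡n) (trans (^-*-assoc 2 ℓ n) (cong (2 ^_) (*-comm ℓ n)))) ⟩
  2 * c * 2 ^ m * 2 ^ (n * ℓ) ∎
  where
  open ≤-Reasoning
  m = ∣ A ∣
  m' = ∣ ∁ A ∣
  m+m'≡n = ∣p∣+∣∁p∣≡n A
  N = 2 ^ ℓ
  k = 2 * 2 ^ ℓ / 3
  c = N C k
  instance _ = >-nonZero (k≤n⇒nCk>0 ([2*2^ℓ/3]≤2^ℓ ℓ))
  reorder : ∀ c t q → c * (2 * t * q) ≡ 2 * c * t * q
  reorder = solve-∀
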